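{- Let $G$ be a graph that has no isolated vertex, no isolated edge (two adjacent vertices both of degree 1), and no pendant triangle (three pairwise adjacent vertices $u,v,w$ with $\deg(u)=\deg(w)=2$). Let $(D,A,C)$ be its Gallai–Edmonds decomposition and let $S$ be the vertex set of a connected component of $G[D]$ such that $G[S]$ is a triangle. Then there exist two distinct vertices $u, v \in S$ such that $u$ has a neighbor $u' \in A$ and $v$ has a neighbor $v' \in A$ (possibly $u' = v'$).
   Context: All graphs are finite, simple and undirected. The Gallai–Edmonds decomposition of $G$ is the partition of $V(G)$ into $D = \{v : \text{some maximum matching of } G \text{ misses } v\}$, $A = N(D)$ (vertices outside $D$ adjacent to $D$), and $C = V(G) \setminus (A \cup D)$. -}

module Defs where

open import Data.Nat using (ℕ; zero; suc; _+_; _≤_)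
open import Data.Fin using (Fin)
open import Data.Bool using (Bool; true; false; if_then_else_)
open import Data.Maybe using (Maybe; just; nothing; is-just)
open import Data.List using (List; map; allFin)
open import Data.Nat.ListAction using (sum)
open import Data.Product using (Σ; ∃; ∃-syntax; _×_; _,_)
open import Data.Sum using (_⊎_)
open import Relation.Nullary using (¬_)
open import Relation.Binary.PropositionalEquality using (_≡_; _≢_)

record Graph (n : ℕ) : Set where
  field
    adj    : Fin n → Fin n → Bool
    sym    : ∀ u v → adj u v ≡ adj v u
    irrefl : ∀ v → adj v v ≡ false

module _ {n : ℕ} (G : Graph n) where
  open Graph G

  Adj : Fin n → Fin n → Set
  Adj u v = adj u v ≡ true

  countB : (Fin n → Bool) → ℕ
  countB p = sum (map (λ w → if p w then 1 else 0) (allFin n))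

  degree : Fin n → ℕ
  degree v = countB (adj v)

  -- A matching, given by its partner function: partner v ≡ just w means
  -- the edge vw is in the matching; nothing means v is unmatched.
  record Matching : Set where
    field
      partner     : Fin n → Maybe (Fin n)
      partner-sym : ∀ u v → partner u ≡ just v → partner v ≡ just u
      partner-adj : ∀ u v → partner u ≡ just v → Adj u v

  -- number of vertices covered by the matching (= 2 × number of edges)
  covered : Matching → ℕ
  covered M = countB (λ v → is-just (Matching.partner M v))

  IsMaximumMatching : Matching → Set
  IsMaximumMatching M = ∀ (M' : Matching) → covered M' ≤ covered M

  GE-D : Fin n → Set
  GE-D v = Σ Matching λ M → IsMaximumMatching M × Matching.partner M v ≡ nothing

  GE-A : Fin n → Set
  GE-A v = ¬ GE-D v × ∃[ w ] (GE-D w × Adj v w)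

  GE-C : Fin n → Set
  GE-C v = ¬ GE-D v × ¬ GE-A v

  data ReachD : Fin n → Fin n → Set where
    here : ∀ {v} → GE-D v → ReachD v v
    step : ∀ {u v w} → GE-D u → Adj u v → ReachD v w → ReachD u w

  IsComponentOfD : (Fin n → Set) → Set
  IsComponentOfD S =
    (∃[ x ] S x) ×
    (∀ x → S x → ∀ y → (S y → ReachD x y) × (ReachD x y → S y))

  InducesTriangle : (Fin n → Set) → Set
  InducesTriangle S =
    ∃[ a ] ∃[ b ] ∃[ c ]
      (a ≢ b × b ≢ c × a ≢ c × Adj a b × Adj b c × Adj a c ×
       (∀ x → (S x → (x ≡ a ⊎ x ≡ b ⊎ x ≡ c)) × ((x ≡ a ⊎ x ≡ b ⊎ x ≡ c) → S x)))

  NoIsolatedVertex : Set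
  NoIsolatedVertex = ∀ v → degree v ≢ 0

  NoIsolatedEdge : Set
  NoIsolatedEdge = ∀ u v → Adj u v → ¬ (degree u ≡ 1 × degree v ≡ 1)

  NoPendantTriangle : Set
  NoPendantTriangle =
    ∀ u v w → Adj u v → Adj v w → Adj u w → ¬ (degree u ≡ 2 × degree w ≡ 2)

module Submission where

open import Defs
open import Data.Nat using (ℕ; zero; suc; _+_)
open import Data.Nat.Properties using (+-identityʳ; +-comm)
open import Data.Fin using (Fin; zero; suc)
open import Data.Fin.Properties using (any?; suc-injective) renaming (_≟_ to _≟F_)
open import Data.Bool using (true; false; if_then_else_)
open import Data.Bool.Properties using () renaming (_≟_ to _≟B_)
open import Data.List using (map; tabulate)
open import Data.List.Properties using (map-tabulate)
open import Data.Nat.ListAction using (sum)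
open import Data.Product using (∃-syntax; _×_; _,_; proj₁; proj₂)
open import Data.Sum using (_⊎_; inj₁; inj₂)
open import Data.Empty using (⊥-elim)
open import Relation.Nullary using (¬_; yes; no)
open import Relation.Nullary.Decidable using (¬?; _×-dec_; _⊎-dec_; decidable-stable)
open import Relation.Unary using (Pred; Decidable)
open import Function using (_∘_)
open import Level using (0ℓ)
open import Relation.Binary.PropositionalEquality

-- The triangle vertices each either have a neighbour outside S, which cannot lie in D
-- (it would join the component S) and hence lies in A, or have degree exactly 2.
-- Two triangle vertices of degree 2 would form a pendant triangle.

sum-tabulate-0 : ∀ {n} (f : Fin n → ℕ) → (∀ i → f i ≡ 0) → sum (tabulate f) ≡ 0
sum-tabulate-0 {zero}  f f≡0 = refl
sum-tabulate-0 {suc n} f f≡0 rewrite f≡0 zero = sum-tabulate-0 (λ i → f (suc i)) (λ i → f≡0 (suc i))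

sum-tabulate-single : ∀ {n} (p : Fin n) (f : Fin n → ℕ) →
  (∀ i → i ≢ p → f i ≡ 0) → sum (tabulate f) ≡ f p
sum-tabulate-single zero f f≡0
  rewrite sum-tabulate-0 (λ i → f (suc i)) (λ i → f≡0 (suc i) (λ ())) = +-identityʳ (f zero)
sum-tabulate-single (suc p) f f≡0 rewrite f≡0 zero (λ ()) =
  sum-tabulate-single p (λ i → f (suc i)) (λ i i≢p → f≡0 (suc i) (i≢p ∘ suc-injective))

sum-tabulate-pair : ∀ {n} (p q : Fin n) (f : Fin n → ℕ) → p ≢ q →
  (∀ i → i ≢ p → i ≢ q → f i ≡ 0) → sum (tabulate f) ≡ f p + f q
sum-tabulate-pair zero zero f p≢q f≡0 = ⊥-elim (p≢q refl)
sum-tabulate-pair zero (suc q) f p≢q f≡0 =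
  cong (f zero +_) (sum-tabulate-single q (λ i → f (suc i))
    (λ i i≢q → f≡0 (suc i) (λ ()) (λ e → i≢q (suc-injective e))))
sum-tabulate-pair (suc p) zero f p≢q f≡0 =
  trans (cong (f zero +_) (sum-tabulate-single p (λ i → f (suc i))
          (λ i i≢p → f≡0 (suc i) (λ e → i≢p (suc-injective e)) (λ ()))))
        (+-comm (f zero) (f (suc p)))
sum-tabulate-pair (suc p) (suc q) f p≢q f≡0 rewrite f≡0 zero (λ ()) (λ ()) =
  sum-tabulate-pair p q (λ i → f (suc i)) (λ e → p≢q (cong suc e))
    (λ i i≢p i≢q → f≡0 (suc i) (λ e → i≢p (suc-injective e)) (λ e → i≢q (suc-injective e)))

module _ {n : ℕ} (G : Graph n) where
  open Graph G using (adj; irrefl)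

  Adj-sym : ∀ {u v} → Adj G u v → Adj G v u
  Adj-sym {u} {v} uv = trans (Graph.sym G v u) uv

  ¬Adj-refl : ∀ {u} → ¬ Adj G u u
  ¬Adj-refl {u} uu with () ← trans (sym uu) (irrefl u)

  degree≡2 : ∀ {x p q} → p ≢ q → Adj G x p → Adj G x q →
    (∀ i → Adj G x i → i ≡ p ⊎ i ≡ q) → degree G x ≡ 2
  degree≡2 {x} {p} {q} p≢q xp xq N[x]⊆pq = begin
    sum (map indicator (tabulate (λ i → i)))  ≡⟨ cong sum (map-tabulate (λ i → i) indicator) ⟩
    sum (tabulate indicator)                  ≡⟨ sum-tabulate-pair p q indicator p≢q indicator≡0 ⟩
    indicator p + indicator q                 ≡⟨ cong₂ (λ s t → (if s then 1 else 0) + (if t then 1 else 0)) xp xq ⟩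
    2                                         ∎
    where
    open ≡-Reasoning
    indicator : Fin n → ℕ
    indicator w = if adj x w then 1 else 0
    indicator≡0 : ∀ i → i ≢ p → i ≢ q → indicator i ≡ 0
    indicator≡0 i i≢p i≢q with adj x i in xi
    ... | false = refl
    ... | true with N[x]⊆pq i xi
    ...   | inj₁ i≡p = ⊥-elim (i≢p i≡p)
    ...   | inj₂ i≡q = ⊥-elim (i≢q i≡q)

  neighbour-outside-or-neighbourhood⊆ : ∀ {P : Pred (Fin n) 0ℓ} → Decidable P → ∀ x →
    (∃[ y ] (Adj G x y × ¬ P y)) ⊎ (∀ y → Adj G x y → P y)
  neighbour-outside-or-neighbourhood⊆ P? x with any? (λ y → (adj x y ≟B true) ×-dec ¬? (P? y))
  ... | yes outside = inj₁ outside
  ... | no ¬outside = inj₂ λ y xy → decidable-stable (P? y) (λ ¬Py → ¬outside (y , xy , ¬Py))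

  ReachD⇒GE-D : ∀ {x y} → ReachD G x y → GE-D G x
  ReachD⇒GE-D (here d)     = d
  ReachD⇒GE-D (step d _ _) = d

  neighbour-outside-component∈A : ∀ {S x y} → IsComponentOfD G S → S x → Adj G x y → ¬ S y → GE-A G y
  neighbour-outside-component∈A {S} {x} {y} (_ , component) Sx xy ¬Sy = y∉D , x , x∈D , Adj-sym xy
    where
    x∈D : GE-D G x
    x∈D = ReachD⇒GE-D (proj₁ (component x Sx x) Sx)
    y∉D : ¬ GE-D G y
    y∉D y∈D = ¬Sy (proj₂ (component x Sx y) (step x∈D xy (here y∈D)))

  Triple : Fin n → Fin n → Fin n → Pred (Fin n) 0ℓ
  Triple a b c i = i ≡ a ⊎ i ≡ b ⊎ i ≡ c

  Triple-rotate : ∀ {a b c i} → Triple a b c i → Triple b c a i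
  Triple-rotate (inj₁ i≡a)        = inj₂ (inj₂ i≡a)
  Triple-rotate (inj₂ (inj₁ i≡b)) = inj₁ i≡b
  Triple-rotate (inj₂ (inj₂ i≡c)) = inj₂ (inj₁ i≡c)

  HasNeighbourInA : Fin n → Set
  HasNeighbourInA x = ∃[ x' ] (GE-A G x' × Adj G x x')

  triangle-vertex-neighbourInA-or-degree≡2 : ∀ {S x p q} → IsComponentOfD G S →
    (∀ i → S i → Triple x p q i) → S x → p ≢ q → Adj G x p → Adj G x q →
    HasNeighbourInA x ⊎ degree G x ≡ 2
  triangle-vertex-neighbourInA-or-degree≡2 {S} {x} {p} {q} comp S⊆xpq Sx p≢q xp xq
    with neighbour-outside-or-neighbourhood⊆ (λ i → (i ≟F x) ⊎-dec (i ≟F p) ⊎-dec (i ≟F q)) x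
  ... | inj₁ (y , xy , y∉xpq) = inj₁ (y , neighbour-outside-component∈A comp Sx xy (y∉xpq ∘ S⊆xpq y) , xy)
  ... | inj₂ N[x]⊆xpq = inj₂ (degree≡2 p≢q xp xq N[x]⊆pq)
    where
    N[x]⊆pq : ∀ i → Adj G x i → i ≡ p ⊎ i ≡ q
    N[x]⊆pq i xi with N[x]⊆xpq i xi
    ... | inj₁ refl = ⊥-elim (¬Adj-refl xi)
    ... | inj₂ i∈pq = i∈pq

lemma10 : ∀ {n : ℕ} (G : Graph n) →
    NoIsolatedVertex G → NoIsolatedEdge G → NoPendantTriangle G →
    (S : Fin n → Set) → IsComponentOfD G S → InducesTriangle G S →
    ∃[ u ] ∃[ v ] (u ≢ v × S u × S v ×
    (∃[ u' ] (GE-A G u' × Adj G u u')) × (∃[ v' ] (GE-A G v' × Adj G v v')))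
lemma10 G _ _ noPendant S comp (a , b , c , a≢b , b≢c , a≢c , ab , bc , ac , S≡abc) =
  choose (classify S⊆abc Sa b≢c ab ac)
         (classify (λ i → Triple-rotate G ∘ S⊆abc i) Sb (≢-sym a≢c) bc (Adj-sym G ab))
         (classify (λ i → Triple-rotate G ∘ Triple-rotate G ∘ S⊆abc i) Sc a≢b (Adj-sym G ac) (Adj-sym G bc))
  where
  S⊆abc : ∀ i → S i → Triple G a b c i
  S⊆abc i = proj₁ (S≡abc i)
  Sa : S a
  Sa = proj₂ (S≡abc a) (inj₁ refl)
  Sb : S b
  Sb = proj₂ (S≡abc b) (inj₂ (inj₁ refl))
  Sc : S c
  Sc = proj₂ (S≡abc c) (inj₂ (inj₂ refl))
  classify : ∀ {x p q} → (∀ i → S i → Triple G x p q i) → S x → p ≢ q →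
    Adj G x p → Adj G x q → HasNeighbourInA G x ⊎ degree G x ≡ 2
  classify = triangle-vertex-neighbourInA-or-degree≡2 G comp
  choose : HasNeighbourInA G a ⊎ degree G a ≡ 2 → HasNeighbourInA G b ⊎ degree G b ≡ 2 →
    HasNeighbourInA G c ⊎ degree G c ≡ 2 →
    ∃[ u ] ∃[ v ] (u ≢ v × S u × S v × HasNeighbourInA G u × HasNeighbourInA G v)
  choose (inj₁ aA) (inj₁ bA) _        = a , b , a≢b , Sa , Sb , aA , bA
  choose (inj₁ aA) (inj₂ _)  (inj₁ cA) = a , c , a≢c , Sa , Sc , aA , cA
  choose (inj₂ _)  (inj₁ bA) (inj₁ cA) = b , c , b≢c , Sb , Sc , bA , cA
  choose (inj₂ a2) (inj₂ b2) _        = ⊥-elim (noPendant a c b ac (Adj-sym G bc) ab (a2 , b2))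
  choose (inj₂ a2) (inj₁ _)  (inj₂ c2) = ⊥-elim (noPendant a b c ab bc ac (a2 , c2))
  choose (inj₁ _)  (inj₂ b2) (inj₂ c2) = ⊥-elim (noPendant b a c (Adj-sym G ab) ac bc (b2 , c2))
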